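{- Let $\mathcal{F}$ be a finite family of sets with levels $\mathcal{F}_1,\dots,\mathcal{F}_t$, auxiliary graph $H=H(\mathcal{F})$, let $\alpha$ be the maximum size of a union-free subfamily of $\mathcal{F}$, and let $I_1,I_2,\dots$ be the sets produced by the greedy procedure described in the context. Then for every $i>1$, $\sum_{j\in I_i}|\mathcal{F}_j|\le \alpha-2i+3$.
   Context: A family of sets is union-free if there are no three distinct sets $X,Y,Z$ in it with $X\cup Y=Z$. Let $\mathcal{F}$ be a finite nonempty family of sets, partially ordered by inclusion, and let $t$ be the maximum number of sets in a chain of $\mathcal{F}$. Define the levels: $\mathcal{F}_t$ is the family of maximal (by inclusion) sets in $\mathcal{F}$, and for $i=t-1,\dots,1$, $\mathcal{F}_i$ is the family of maximal sets in $\mathcal{F}\setminus\bigcup_{j=i+1}^t\mathcal{F}_j$. A set $X\in\mathcal{F}_i$ is said to have rank $i$. The auxiliary graph $H=H(\mathcal{F})$ has vertex set $\{1,\dots,t\}$, and for $i<i'$ the pair $(i,i')$ is an edge of $H$ if there exist two disjoint chains $\mathcal{X},\mathcal{Y}\subseteq\mathcal{F}$, each starting (smallest element) in $\mathcal{F}_i$ and ending (largest element) in $\mathcal{F}_{i'-1}$, such that (i) $\mathcal{X}$ and $\mathcal{Y}$ both have length (number of sets) $i'-i$, and (ii) at most one set in $\{X\cup Y : X\in\mathcal{X}, Y\in\mathcal{Y}\}$ has rank $i'$, and every other set of this form either has rank greater than $i'$ or does not belong to $\mathcal{F}$. Greedy procedure: the set $I_1$ starts with vertex $1$; having chosen its $j$th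 element $a^1_j$, let $a^1_{j+1}$ be the least vertex $>a^1_j$ not adjacent in $H$ to $a^1_j$, and add it; stop when no such vertex exists. Having constructed $I_1,\dots,I_i$, the set $I_{i+1}$ starts with the least vertex $a^{i+1}_1$ not in $I_1\cup\dots\cup I_i$; having chosen its $j$th element $a^{i+1}_j$, let $a^{i+1}_{j+1}$ be the least vertex $>a^{i+1}_j$ that is not in $I_1\cup\dots\cup I_i$ and not adjacent in $H$ to $a^{i+1}_j$, and add it; stop when no such vertex exists. Continue until every vertex of $H$ lies in some $I_i$. -}

module Defs where

open import Data.Nat using (ℕ; zero; suc; _+_; _∸_; _≤_; _<_; _≡ᵇ_; _<ᵇ_)
open import Data.Bool using (Bool; true; false; not; _∧_; _∨_; if_then_else_)
open import Data.List using (List; []; _∷_; length; filter; map; upTo; _++_)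
open import Data.Bool.ListAction using (any)
open import Data.Nat.ListAction using (sum)
open import Data.List.Membership.Propositional using (_∈_; _∉_)
open import Data.List.Relation.Unary.All using (All)
open import Data.List.Relation.Unary.Any using (Any)
open import Data.List.Relation.Unary.Linked using (Linked)
open import Data.List.Relation.Unary.Unique.Propositional using (Unique)
open import Data.Fin.Subset using (Subset; _⊂_; _∪_)
open import Data.Fin.Subset.Properties using (_⊂?_)
open import Data.Bool.Properties using (T?)
open import Data.Empty using (⊥)
open import Data.Maybe using (Maybe; just; nothing)
open import Data.Product using (Σ; ∃; _×_; _,_)
open import Relation.Binary.PropositionalEquality using (_≡_; _≢_)
open import Relation.Nullary using (¬_; does)
open import Relation.Nullary.Decidable using (¬?)

-- Throughout, sets are subsets of a finite ground set Fin n, and a finite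
-- family of sets is a duplicate-free list of such subsets.

module _ {n : ℕ} where

  IsChain : List (Subset n) → List (Subset n) → Set
  IsChain 𝓕 c = All (_∈ 𝓕) c × Linked _⊂_ c

  IsMaxChainLength : List (Subset n) → ℕ → Set
  IsMaxChainLength 𝓕 t =
    (Σ (List (Subset n)) λ c → IsChain 𝓕 c × length c ≡ t)
    × (∀ c → IsChain 𝓕 c → length c ≤ t)

  isMaximal : List (Subset n) → Subset n → Bool
  isMaximal G X = not (any (λ Y → does (X ⊂? Y)) G)

  peel : ℕ → List (Subset n) → List (Subset n)
  peel zero G = G
  peel (suc k) G = filter (λ X → ¬? (T? (isMaximal (peel k G) X))) (peel k G)

  topLayer : ℕ → List (Subset n) → List (Subset n)
  topLayer k G = filter (λ X → T? (isMaximal (peel k G) X)) (peel k G)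

  -- level 𝓕_i (for 1 ≤ i ≤ t): 𝓕_t = maximal sets of 𝓕,
  -- 𝓕_i = maximal sets of 𝓕 ∖ (𝓕_{i+1} ∪ … ∪ 𝓕_t)
  level : List (Subset n) → (t i : ℕ) → List (Subset n)
  level 𝓕 t i = topLayer (t ∸ i) 𝓕

  HasRank : List (Subset n) → (t : ℕ) → Subset n → ℕ → Set
  HasRank 𝓕 t X r = 1 ≤ r × r ≤ t × X ∈ level 𝓕 t r

  lastOf : {A : Set} → A → List A → A
  lastOf x [] = x
  lastOf x (y ∷ ys) = lastOf y ys

  IsLinkChain : List (Subset n) → (t i i' : ℕ) → List (Subset n) → Set
  IsLinkChain 𝓕 t i i' [] = ⊥  -- (length i' - i ≥ 1, so chains are nonempty)
  IsLinkChain 𝓕 t i i' (x ∷ xs) =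
    IsChain 𝓕 (x ∷ xs) × length (x ∷ xs) ≡ i' ∸ i
    × HasRank 𝓕 t x i × HasRank 𝓕 t (lastOf x xs) (i' ∸ 1)

  Edge : List (Subset n) → (t : ℕ) → ℕ → ℕ → Set
  Edge 𝓕 t i i' =
    1 ≤ i × i < i' × i' ≤ t ×
    Σ (List (Subset n)) λ 𝓧 → Σ (List (Subset n)) λ 𝓨 →
      IsLinkChain 𝓕 t i i' 𝓧 × IsLinkChain 𝓕 t i i' 𝓨
      × (∀ Z → Z ∈ 𝓧 → Z ∉ 𝓨)
      × (∀ X₁ Y₁ X₂ Y₂ → X₁ ∈ 𝓧 → Y₁ ∈ 𝓨 → X₂ ∈ 𝓧 → Y₂ ∈ 𝓨 →
           HasRank 𝓕 t (X₁ ∪ Y₁) i' → HasRank 𝓕 t (X₂ ∪ Y₂) i' →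
           X₁ ∪ Y₁ ≡ X₂ ∪ Y₂)
      × (∀ X Y r → X ∈ 𝓧 → Y ∈ 𝓨 → HasRank 𝓕 t (X ∪ Y) r → i' ≤ r)

  UnionFree : List (Subset n) → Set
  UnionFree G = ∀ X Y Z → X ∈ G → Y ∈ G → Z ∈ G →
    X ≢ Y → Y ≢ Z → X ≢ Z → X ∪ Y ≢ Z

  IsMaxUnionFree : List (Subset n) → ℕ → Set
  IsMaxUnionFree 𝓕 α =
    (Σ (List (Subset n)) λ G → Unique G × All (_∈ 𝓕) G × UnionFree G × length G ≡ α)
    × (∀ G → Unique G → All (_∈ 𝓕) G → UnionFree G → length G ≤ α)

-- Greedy procedure on vertices 1 … t, given a boolean adjacency test
-- adj a b (queried only for a < b).

vertices : ℕ → List ℕ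
vertices t = map suc (upTo t)

memᵇ : ℕ → List ℕ → Bool
memᵇ v us = any (λ u → u ≡ᵇ v) us

firstWith : (ℕ → Bool) → List ℕ → Maybe ℕ
firstWith p [] = nothing
firstWith p (v ∷ vs) = if p v then just v else firstWith p vs

extendSet : (adj : ℕ → ℕ → Bool) (t : ℕ) (used : List ℕ) (cur : ℕ) (fuel : ℕ) → List ℕ
extendSet adj t used cur zero = []
extendSet adj t used cur (suc fuel) with
  firstWith (λ v → (cur <ᵇ v) ∧ not (memᵇ v used) ∧ not (adj cur v)) (vertices t)
... | nothing = []
... | just v = v ∷ extendSet adj t used v fuel

greedyFrom : (adj : ℕ → ℕ → Bool) (t : ℕ) (used : List ℕ) (fuel : ℕ) → List (List ℕ)
greedyFrom adj t used zero = []
greedyFrom adj t used (suc fuel) with firstWith (λ v → not (memᵇ v used)) (vertices t)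
... | nothing = []
... | just a = (a ∷ extendSet adj t used a t) ∷
               greedyFrom adj t (used ++ (a ∷ extendSet adj t used a t)) fuel

greedy : (adj : ℕ → ℕ → Bool) (t : ℕ) → List (List ℕ)
greedy adj t = greedyFrom adj t [] t

levelSizeSum : {n : ℕ} → List (Subset n) → (t : ℕ) → List ℕ → ℕ
levelSizeSum 𝓕 t I = sum (map (λ j → length (level 𝓕 t j)) I)

-- Let I = a ∷ as be the (p+1)-st greedy set, p ≥ 1. Each earlier set skipped a, so it contains
-- a vertex b < a adjacent to a in H; these p vertices are distinct, so if m is the least of them
-- then p ≤ a - m. The edge (m , a) provides disjoint chains 𝓧, 𝓨 of a - m sets each, of ranks in
-- [m, a). The family consisting of 𝓧, 𝓨, the levels 𝓕_j for j ∈ as, and 𝓕_a minus the at most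
-- one set of the form X ∪ Y (X ∈ 𝓧, Y ∈ 𝓨) is union-free. A union of two of its members
-- landing in 𝓕_j, j ∈ as, would make (i , j) an edge of H for the predecessor i of j in I: lift
-- both members to rank i and climb to rank j - 1. A union landing at rank at most a joins two
-- chain members, so it is some X ∪ Y with X ∈ 𝓧, Y ∈ 𝓨; those have rank at least a and were
-- removed from 𝓕_a. Hence α ≥ Σ_{j ∈ I} |𝓕_j| - 1 + 2 (a - m) ≥ Σ_{j ∈ I} |𝓕_j| - 1 + 2p.

module Submission where

open import Defs
open import Data.Nat using (ℕ; zero; suc; _+_; _*_; _∸_; _≤_; _<_; z≤n; s≤s; _≡ᵇ_; _<ᵇ_)
open import Data.Nat.Properties
open import Data.Nat.Solver using (module +-*-Solver)
open import Data.Bool as Bool using (Bool; true; false; not; _∧_; T)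
open import Data.Bool.Properties using (T?; not-injective)
open import Data.Maybe using (just; nothing)
open import Data.Empty using (⊥; ⊥-elim)
open import Data.Sum using (_⊎_; inj₁; inj₂; [_,_])
open import Data.Product using (∃; _×_; _,_; proj₁; proj₂)
open import Data.List using (List; []; _∷_; _++_; length; filter)
open import Data.List.Properties using (length-++; filter-all; ∷-injectiveˡ; ∷-injectiveʳ)
open import Data.List.Extrema.Nat using (min; argmin-all; min≤⊤; min≤xs)
open import Data.List.Membership.Propositional using (_∈_; _∉_; lose; find)
open import Data.List.Membership.Propositional.Properties
  using (∈-filter⁺; ∈-filter⁻; ∈-++⁻; ∈-map⁺; ∈-map⁻; ∈-upTo⁺; ∈-upTo⁻)
open import Data.List.Relation.Unary.All as All using (All; []; _∷_)
open import Data.List.Relation.Unary.Any using (Any; here; there; any?)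
open import Data.List.Relation.Unary.AllPairs as AllPairs using (AllPairs; []; _∷_)
import Data.List.Relation.Unary.AllPairs.Properties as AllPairsₚ
open import Data.List.Relation.Unary.Linked as Linked using (Linked; []; [-]; _∷_)
open import Data.List.Relation.Unary.Linked.Properties using (Linked⇒AllPairs)
open import Data.List.Relation.Unary.Unique.Propositional using (Unique)
import Data.List.Relation.Unary.Unique.Propositional.Properties as Uniqueₚ
open import Data.List.Relation.Binary.Disjoint.Propositional using (Disjoint)
open import Data.Fin.Subset using (Subset; _⊂_; _⊆_; _∪_)
open import Data.Fin.Subset.Properties
  using (_⊂?_; ⊂-irref; ⊂-trans; p⊂q⇒p⊆q; drop-∷-⊆; out⊂; out⊂in; in⊂in;
         x∈p∪q⁻; p⊆p∪q; q⊆p∪q; ∪-idem; ∪-comm; ⊆-trans; ⊆-refl; ⊆-antisym)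
open import Data.Vec.Base as Vec using ([]; _∷_)
open import Data.Vec.Properties using (≡-dec)
open import Function using (_∘_; case_of_)
open import Function.Bundles using (_⇔_; Equivalence)
open import Relation.Binary.Definitions using (tri<; tri≈; tri>)
open import Relation.Binary.PropositionalEquality
  using (_≡_; _≢_; refl; sym; trans; cong; cong₂; subst; module ≡-Reasoning)
open import Relation.Nullary using (¬_; yes; no; Dec)
open import Relation.Nullary.Decidable using (¬?)
open import Relation.Unary using (Decidable)

⊆∧≢⇒⊂ : ∀ {n} {p q : Subset n} → p ⊆ q → p ≢ q → p ⊂ q
⊆∧≢⇒⊂ {p = []}        {[]}        _   p≢q = ⊥-elim (p≢q refl)
⊆∧≢⇒⊂ {p = false ∷ p} {false ∷ q} p⊆q p≢q = out⊂ (⊆∧≢⇒⊂ (drop-∷-⊆ p⊆q) (p≢q ∘ cong (false ∷_)))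
⊆∧≢⇒⊂ {p = false ∷ p} {true ∷ q}  p⊆q _   = out⊂in (drop-∷-⊆ p⊆q)
⊆∧≢⇒⊂ {p = true ∷ p}  {false ∷ q} p⊆q _   with p⊆q Vec.here
... | ()
⊆∧≢⇒⊂ {p = true ∷ p}  {true ∷ q}  p⊆q p≢q = in⊂in (⊆∧≢⇒⊂ (drop-∷-⊆ p⊆q) (p≢q ∘ cong (true ∷_)))

module _ {n : ℕ} where

  _≟ˢ_ : (p q : Subset n) → Dec (p ≡ q)
  _≟ˢ_ = ≡-dec Bool._≟_

  ∪-least : {p q r : Subset n} → p ⊆ r → q ⊆ r → p ∪ q ⊆ r
  ∪-least {p} {q} p⊆r q⊆r x∈p∪q with x∈p∪q⁻ p q x∈p∪q
  ... | inj₁ x∈p = p⊆r x∈p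
  ... | inj₂ x∈q = q⊆r x∈q

  ∪-mono : {p q r s : Subset n} → p ⊆ r → q ⊆ s → p ∪ q ⊆ r ∪ s
  ∪-mono {r = r} {s} p⊆r q⊆s = ∪-least (⊆-trans p⊆r (p⊆p∪q s)) (⊆-trans q⊆s (q⊆p∪q r s))

  ⊆⇒∪≡ʳ : {p q : Subset n} → p ⊆ q → p ∪ q ≡ q
  ⊆⇒∪≡ʳ {p} {q} p⊆q = ⊆-antisym (∪-least p⊆q ⊆-refl) (q⊆p∪q p q)

  isMaximal⇒¬⊂ : ∀ (G : List (Subset n)) {X Y} → T (isMaximal G X) → Y ∈ G → ¬ X ⊂ Y
  isMaximal⇒¬⊂ (Z ∷ G) {X} max Y∈ X⊂Y with X ⊂? Z | Y∈
  ... | yes _   | _          = max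
  ... | no X⊄Z  | here refl  = X⊄Z X⊂Y
  ... | no _    | there Y∈G  = isMaximal⇒¬⊂ G max Y∈G X⊂Y

  ¬isMaximal⇒⊂ : ∀ (G : List (Subset n)) {X} → ¬ T (isMaximal G X) → ∃ λ Y → Y ∈ G × X ⊂ Y
  ¬isMaximal⇒⊂ []      ¬max = ⊥-elim (¬max _)
  ¬isMaximal⇒⊂ (Z ∷ G) {X} ¬max with X ⊂? Z
  ... | yes X⊂Z = Z , here refl , X⊂Z
  ... | no _ with ¬isMaximal⇒⊂ G ¬max
  ...   | Y , Y∈G , X⊂Y = Y , there Y∈G , X⊂Y

  Linked⊂-head⊆ : ∀ {X : Subset n} {xs W} → Linked _⊂_ (X ∷ xs) → W ∈ X ∷ xs → X ⊆ W
  Linked⊂-head⊆ _                      (here refl) = ⊆-refl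
  Linked⊂-head⊆ {xs = _ ∷ _} (X⊂ ∷ ch) (there W∈)  = ⊆-trans (p⊂q⇒p⊆q X⊂) (Linked⊂-head⊆ ch W∈)

  Linked⊂-⊆last : ∀ {X : Subset n} {xs W} → Linked _⊂_ (X ∷ xs) → W ∈ X ∷ xs → W ⊆ lastOf {n} X xs
  Linked⊂-⊆last {xs = []}    _         (here refl) = ⊆-refl
  Linked⊂-⊆last {xs = _ ∷ _} (X⊂ ∷ ch) (here refl) =
    ⊆-trans (p⊂q⇒p⊆q X⊂) (Linked⊂-⊆last ch (here refl))
  Linked⊂-⊆last {xs = _ ∷ _} (_ ∷ ch)  (there W∈)  = Linked⊂-⊆last ch W∈

  Linked⊂-total : ∀ {c : List (Subset n)} {W V} → Linked _⊂_ c → W ∈ c → V ∈ c → W ⊆ V ⊎ V ⊆ W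
  Linked⊂-total ch          (here refl) V∈          = inj₁ (Linked⊂-head⊆ ch V∈)
  Linked⊂-total ch          W∈          (here refl) = inj₂ (Linked⊂-head⊆ ch W∈)
  Linked⊂-total (_ ∷ ch)    (there W∈)  (there V∈)  = Linked⊂-total ch W∈ V∈
  Linked⊂-total [-]         (there ())  _

  Linked⊂-∪-selective : ∀ {c : List (Subset n)} {W V} → Linked _⊂_ c → W ∈ c → V ∈ c →
    W ∪ V ≡ W ⊎ W ∪ V ≡ V
  Linked⊂-∪-selective {W = W} {V} ch W∈ V∈ with Linked⊂-total ch W∈ V∈
  ... | inj₁ W⊆V = inj₂ (⊆⇒∪≡ʳ W⊆V)
  ... | inj₂ V⊆W = inj₁ (trans (∪-comm W V) (⊆⇒∪≡ʳ V⊆W))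

  Linked⊂⇒Unique : ∀ {c : List (Subset n)} → Linked _⊂_ c → Unique c
  Linked⊂⇒Unique ch = AllPairs.map (λ X⊂Y X≡Y → ⊂-irref X≡Y X⊂Y) (Linked⇒AllPairs ⊂-trans ch)

module Ranks {n : ℕ} (𝓕 : List (Subset n)) (t : ℕ)
             (chain≤t : ∀ c → IsChain 𝓕 c → length c ≤ t) where

  private
    P : ℕ → List (Subset n)
    P k = peel k 𝓕

    Maximal : ℕ → Subset n → Set
    Maximal k X = T (isMaximal (P k) X)

    peel⁻ : ∀ k {X} → X ∈ P (suc k) → X ∈ P k × ¬ Maximal k X
    peel⁻ k = ∈-filter⁻ (λ X → ¬? (T? (isMaximal (P k) X)))

    peel⁺ : ∀ k {X} → X ∈ P k → ¬ Maximal k X → X ∈ P (suc k)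
    peel⁺ k = ∈-filter⁺ (λ X → ¬? (T? (isMaximal (P k) X)))

    topLayer⁻ : ∀ k {X} → X ∈ topLayer k 𝓕 → X ∈ P k × Maximal k X
    topLayer⁻ k = ∈-filter⁻ (λ X → T? (isMaximal (P k) X))

    topLayer⁺ : ∀ k {X} → X ∈ P k → Maximal k X → X ∈ topLayer k 𝓕
    topLayer⁺ k = ∈-filter⁺ (λ X → T? (isMaximal (P k) X))

    peel⊆𝓕 : ∀ k {X} → X ∈ P k → X ∈ 𝓕
    peel⊆𝓕 zero    X∈ = X∈
    peel⊆𝓕 (suc k) X∈ = peel⊆𝓕 k (proj₁ (peel⁻ k X∈))

    peel-anti : ∀ {j k X} → j ≤ k → X ∈ P k → X ∈ P j
    peel-anti {k = zero}  z≤n X∈ = X∈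
    peel-anti {k = suc k} j≤k X∈ with m≤n⇒m<n∨m≡n j≤k
    ... | inj₂ refl      = X∈
    ... | inj₁ (s≤s j≤k) = peel-anti j≤k (proj₁ (peel⁻ k X∈))

    ⊂-peel : ∀ j {X Y} → X ∈ 𝓕 → X ⊂ Y → Y ∈ P j → X ∈ P (suc j)
    ⊂-peel zero    X∈ X⊂Y Y∈ = peel⁺ zero X∈ (λ max → isMaximal⇒¬⊂ 𝓕 max Y∈ X⊂Y)
    ⊂-peel (suc j) X∈ X⊂Y Y∈ =
      peel⁺ (suc j) (⊂-peel j X∈ X⊂Y (proj₁ (peel⁻ j Y∈)))
        (λ max → isMaximal⇒¬⊂ (P (suc j)) max Y∈ X⊂Y)

    chainAbove : ∀ k {X} → X ∈ P k → ∃ λ c → IsChain 𝓕 (X ∷ c) × length c ≡ k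
    chainAbove zero    X∈ = [] , (X∈ ∷ [] , [-]) , refl
    chainAbove (suc k) X∈ with ¬isMaximal⇒⊂ (P k) (proj₂ (peel⁻ k X∈))
    ... | Y , Y∈ , X⊂Y with chainAbove k Y∈
    ...   | c , (c⊆𝓕 , ch) , len = Y ∷ c , (peel⊆𝓕 (suc k) X∈ ∷ c⊆𝓕 , X⊂Y ∷ ch) , cong suc len

    -- A set surviving t peelings would sit at the bottom of a chain of t + 1 sets.
    peel-t-empty : ∀ {X} → X ∉ P t
    peel-t-empty X∈ with chainAbove t X∈
    ... | c , isChain , len = 1+n≰n (subst (λ m → suc m ≤ t) len (chain≤t _ isChain))

    layer-search : ∀ d k {X} → k + d ≡ t → X ∈ P k → ∃ λ j → j < t × X ∈ topLayer j 𝓕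
    layer-search zero    k {X} k≡t X∈ =
      ⊥-elim (peel-t-empty (subst (λ m → X ∈ P m) (trans (sym (+-identityʳ k)) k≡t) X∈))
    layer-search (suc d) k {X} k+d≡t X∈ with T? (isMaximal (P k) X)
    ... | yes max = k , subst (k <_) k+d≡t (m<m+n k (s≤s z≤n)) , topLayer⁺ k X∈ max
    ... | no ¬max = layer-search d (suc k) (trans (sym (+-suc k d)) k+d≡t) (peel⁺ k X∈ ¬max)

    layer-exists : ∀ {X} → X ∈ 𝓕 → ∃ λ j → j < t × X ∈ topLayer j 𝓕
    layer-exists = layer-search t 0 refl

    topLayer-peel-suc : ∀ {j k X} → j < k → X ∈ topLayer j 𝓕 → X ∉ P k
    topLayer-peel-suc {j} j<k X∈ X∈Pk =
      proj₂ (peel⁻ j (peel-anti j<k X∈Pk)) (proj₂ (topLayer⁻ j X∈))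

    layer-unique : ∀ {j k X} → X ∈ topLayer j 𝓕 → X ∈ topLayer k 𝓕 → j ≡ k
    layer-unique {j} {k} X∈j X∈k with <-cmp j k
    ... | tri≈ _ j≡k _ = j≡k
    ... | tri< j<k _ _ = ⊥-elim (topLayer-peel-suc j<k X∈j (proj₁ (topLayer⁻ k X∈k)))
    ... | tri> _ _ k<j = ⊥-elim (topLayer-peel-suc k<j X∈k (proj₁ (topLayer⁻ j X∈j)))

    ⊂⇒layer> : ∀ {X Y j k} → X ⊂ Y → X ∈ topLayer j 𝓕 → Y ∈ topLayer k 𝓕 → k < j
    ⊂⇒layer> {X} {Y} {j} {k} X⊂Y X∈ Y∈ with k <? j
    ... | yes k<j = k<j
    ... | no  k≮j = ⊥-elim (topLayer-peel-suc (s≤s (≮⇒≥ k≮j)) X∈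
          (⊂-peel k (peel⊆𝓕 j (proj₁ (topLayer⁻ j X∈))) X⊂Y (proj₁ (topLayer⁻ k Y∈))))

    layer-suc⇒⊂ : ∀ {k X} → X ∈ topLayer (suc k) 𝓕 → ∃ λ Y → X ⊂ Y × Y ∈ topLayer k 𝓕
    layer-suc⇒⊂ {k} X∈ with ¬isMaximal⇒⊂ (P k) (proj₂ (peel⁻ k (proj₁ (topLayer⁻ (suc k) X∈))))
    ... | Y , Y∈Pk , X⊂Y with layer-exists (peel⊆𝓕 k Y∈Pk)
    ...   | j , _ , Y∈j with j <? k
    ...     | yes j<k = ⊥-elim (topLayer-peel-suc j<k Y∈j Y∈Pk)
    ...     | no  j≮k = Y , X⊂Y ,
              subst (λ m → Y ∈ topLayer m 𝓕) (≤-antisym (≤-pred (⊂⇒layer> X⊂Y X∈ Y∈j)) (≮⇒≥ j≮k)) Y∈j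

  R : Subset n → ℕ → Set
  R = HasRank 𝓕 t

  HasRank⇒∈ : ∀ {X r} → R X r → X ∈ 𝓕
  HasRank⇒∈ {r = r} (_ , _ , X∈) = peel⊆𝓕 (t ∸ r) (proj₁ (topLayer⁻ (t ∸ r) X∈))

  rank-exists : ∀ {X} → X ∈ 𝓕 → ∃ λ r → R X r
  rank-exists X∈ with layer-exists X∈
  ... | j , j<t , X∈j = t ∸ j , m<n⇒0<n∸m j<t , m∸n≤m t j ,
                        subst (λ m → _ ∈ topLayer m 𝓕) (sym (m∸[m∸n]≡n (<⇒≤ j<t))) X∈j

  rank-unique : ∀ {X r s} → R X r → R X s → r ≡ s
  rank-unique (_ , r≤t , X∈) (_ , s≤t , X∈′) = ∸-cancelˡ-≡ r≤t s≤t (layer-unique X∈ X∈′)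

  rank-⊂ : ∀ {X Y r s} → X ⊂ Y → R X r → R Y s → r < s
  rank-⊂ {r = r} {s} X⊂Y (_ , _ , X∈) (_ , _ , Y∈) with r <? s
  ... | yes r<s = r<s
  ... | no  r≮s = ⊥-elim (<⇒≱ (⊂⇒layer> X⊂Y X∈ Y∈) (∸-monoʳ-≤ t (≮⇒≥ r≮s)))

  rank-⊆ : ∀ {X Y r s} → X ⊆ Y → R X r → R Y s → r ≤ s
  rank-⊆ {X} {Y} X⊆Y rX rY with X ≟ˢ Y
  ... | yes refl = ≤-reflexive (rank-unique rX rY)
  ... | no  X≢Y  = <⇒≤ (rank-⊂ (⊆∧≢⇒⊂ X⊆Y X≢Y) rX rY)

  rank-⊆-≡ : ∀ {X Y r} → X ⊆ Y → R X r → R Y r → X ≡ Y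
  rank-⊆-≡ {X} {Y} X⊆Y rX rY with X ≟ˢ Y
  ... | yes X≡Y = X≡Y
  ... | no  X≢Y = ⊥-elim (<-irrefl refl (rank-⊂ (⊆∧≢⇒⊂ X⊆Y X≢Y) rX rY))

  rank-suc : ∀ {X r} → R X r → r < t → ∃ λ Y → X ⊂ Y × R Y (suc r)
  rank-suc {X} {r} (_ , _ , X∈) r<t
    with layer-suc⇒⊂ {t ∸ suc r} (subst (λ m → X ∈ topLayer m 𝓕) (+-∸-assoc 1 r<t) X∈)
  ... | Y , X⊂Y , Y∈ = Y , X⊂Y , s≤s z≤n , r<t , Y∈

  level-unique : Unique 𝓕 → ∀ j → Unique (level 𝓕 t j)
  level-unique unique j =
    Uniqueₚ.filter⁺ (λ X → T? (isMaximal (P (t ∸ j)) X)) (peel-unique (t ∸ j))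
    where
    peel-unique : ∀ k → Unique (P k)
    peel-unique zero    = unique
    peel-unique (suc k) = Uniqueₚ.filter⁺ (λ X → ¬? (T? (isMaximal (P k) X))) (peel-unique k)

  Disjoint-by-rank : ∀ {xs ys} {P Q : ℕ → Set} →
    (∀ {W} → W ∈ xs → ∃ λ r → R W r × P r) → (∀ {W} → W ∈ ys → ∃ λ r → R W r × Q r) →
    (∀ {r} → P r → ¬ Q r) → Disjoint xs ys
  Disjoint-by-rank xs-ranked ys-ranked P⇒¬Q (W∈xs , W∈ys) with xs-ranked W∈xs | ys-ranked W∈ys
  ... | r , rW , Pr | s , sW , Qs rewrite rank-unique rW sW = P⇒¬Q Pr Qs

  chainUpFrom : ∀ m {X r} → R X r → r + m ≤ t →
    ∃ λ xs → IsChain 𝓕 (X ∷ xs) × length xs ≡ m × R (lastOf {n} X xs) (r + m)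
  chainUpFrom zero    {X} {r} rX _ =
    [] , (HasRank⇒∈ rX ∷ [] , [-]) , refl , subst (R X) (sym (+-identityʳ r)) rX
  chainUpFrom (suc m) {X} {r} rX r+1+m≤t with subst (_≤ t) (+-suc r m) r+1+m≤t
  ... | r+m<t with rank-suc rX (≤-trans (s≤s (m≤m+n r m)) r+m<t)
  ...   | Y , X⊂Y , rY with chainUpFrom m rY r+m<t
  ...     | ys , (ys⊆𝓕 , ch) , len , rLast =
            Y ∷ ys , (HasRank⇒∈ rX ∷ ys⊆𝓕 , X⊂Y ∷ ch) , cong suc len , subst (R _) (sym (+-suc r m)) rLast

  rank-lift : ∀ {X r c} → R X r → r ≤ c → c ≤ t → ∃ λ X′ → X ⊆ X′ × R X′ c
  rank-lift {X} {r} {c} rX r≤c c≤t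
    with chainUpFrom (c ∸ r) rX (subst (_≤ t) (sym (m+[n∸m]≡n r≤c)) c≤t)
  ... | xs , (_ , ch) , _ , rLast =
        lastOf {n} X xs , Linked⊂-⊆last ch (here refl) , subst (R _) (m+[n∸m]≡n r≤c) rLast

  linkChainFrom : ∀ {X c d} → R X c → c < d → d ≤ t → ∃ λ 𝓧 → IsLinkChain 𝓕 t c d 𝓧 × All (X ⊆_) 𝓧
  linkChainFrom {X} {c} {suc d} rX (s≤s c≤d) d<t
    with chainUpFrom (d ∸ c) rX (subst (_≤ t) (sym (m+[n∸m]≡n c≤d)) (<⇒≤ d<t))
  ... | xs , isChain@(_ , ch) , len , rLast =
        X ∷ xs ,
        (isChain , trans (cong suc len) (sym (+-∸-assoc 1 c≤d)) , rX , subst (R _) (m+[n∸m]≡n c≤d) rLast) ,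
        All.tabulate (Linked⊂-head⊆ ch)

  IsLinkChain-rank : ∀ {i j c W} → IsLinkChain 𝓕 t i j c → W ∈ c → ∃ λ r → R W r × i ≤ r × r < j
  IsLinkChain-rank {c = _ ∷ _} ((c⊆𝓕 , ch) , _ , rX , rLast) W∈
    with rank-exists (All.lookup c⊆𝓕 W∈)
  ... | r , rW = r , rW , rank-⊆ (Linked⊂-head⊆ ch W∈) rX rW ,
                 ≤pred⇒< (proj₁ rLast) (rank-⊆ (Linked⊂-⊆last ch W∈) rW rLast)
    where
    ≤pred⇒< : ∀ {j r} → 1 ≤ j ∸ 1 → r ≤ j ∸ 1 → r < j
    ≤pred⇒< {suc j} _ r≤j = s≤s r≤j

  IsLinkChain-linked : ∀ {i j c} → IsLinkChain 𝓕 t i j c → Linked _⊂_ c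
  IsLinkChain-linked {c = _ ∷ _} ((_ , ch) , _) = ch

  IsLinkChain-length : ∀ {i j c} → IsLinkChain 𝓕 t i j c → length c ≡ j ∸ i
  IsLinkChain-length {c = _ ∷ _} (_ , len , _) = len

  chains-over-∪⇒Edge : ∀ {X Y c d 𝓧 𝓨} → 1 ≤ c → c < d → R (X ∪ Y) d →
    IsLinkChain 𝓕 t c d 𝓧 → All (X ⊆_) 𝓧 → IsLinkChain 𝓕 t c d 𝓨 → All (Y ⊆_) 𝓨 → Edge 𝓕 t c d
  chains-over-∪⇒Edge {X} {Y} {𝓧 = 𝓧} {𝓨} 1≤c c<d rZ@(_ , d≤t , _) lcX X⊆ lcY Y⊆ =
    1≤c , c<d , d≤t , 𝓧 , 𝓨 , lcX , lcY , disjoint , atMostOne , rank≥d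
    where
    X∪Y⊆ : ∀ {W V} → W ∈ 𝓧 → V ∈ 𝓨 → X ∪ Y ⊆ W ∪ V
    X∪Y⊆ W∈ V∈ = ∪-mono (All.lookup X⊆ W∈) (All.lookup Y⊆ V∈)

    disjoint : ∀ W → W ∈ 𝓧 → W ∉ 𝓨
    disjoint W W∈𝓧 W∈𝓨 with IsLinkChain-rank lcX W∈𝓧
    ... | r , rW , _ , r<d = <⇒≱ r<d (rank-⊆ (subst (X ∪ Y ⊆_) (∪-idem W) (X∪Y⊆ W∈𝓧 W∈𝓨)) rZ rW)

    atMostOne : ∀ X₁ Y₁ X₂ Y₂ → X₁ ∈ 𝓧 → Y₁ ∈ 𝓨 → X₂ ∈ 𝓧 → Y₂ ∈ 𝓨 →
      R (X₁ ∪ Y₁) _ → R (X₂ ∪ Y₂) _ → X₁ ∪ Y₁ ≡ X₂ ∪ Y₂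
    atMostOne _ _ _ _ X₁∈ Y₁∈ X₂∈ Y₂∈ r₁ r₂ =
      trans (sym (rank-⊆-≡ (X∪Y⊆ X₁∈ Y₁∈) rZ r₁)) (rank-⊆-≡ (X∪Y⊆ X₂∈ Y₂∈) rZ r₂)

    rank≥d : ∀ W V r → W ∈ 𝓧 → V ∈ 𝓨 → R (W ∪ V) r → _ ≤ r
    rank≥d _ _ _ W∈ V∈ rWV = rank-⊆ (X∪Y⊆ W∈ V∈) rZ rWV

  -- Lifting X and Y to rank c and climbing to rank d - 1 gives two chains whose
  -- pairwise unions all contain X ∪ Y.
  ∪⇒Edge : ∀ {X Y rX rY c d} → R X rX → R Y rY → rX ≤ c → rY ≤ c → c < d → R (X ∪ Y) d → Edge 𝓕 t c d
  ∪⇒Edge rX rY rX≤c rY≤c c<d rZ@(_ , d≤t , _)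
    with rank-lift rX rX≤c c≤t | rank-lift rY rY≤c c≤t
    where c≤t = ≤-trans (<⇒≤ c<d) d≤t
  ... | X′ , X⊆X′ , rX′ | Y′ , Y⊆Y′ , rY′
    with linkChainFrom rX′ c<d d≤t | linkChainFrom rY′ c<d d≤t
  ...   | 𝓧 , lcX , X′⊆ | 𝓨 , lcY , Y′⊆ =
          chains-over-∪⇒Edge (proj₁ rX′) c<d rZ
            lcX (All.map (⊆-trans X⊆X′) X′⊆) lcY (All.map (⊆-trans Y⊆Y′) Y′⊆)

module _ {A : Set} {Q : A → Set} (Q? : Decidable Q) where

  length≤suc-filter-reject : ∀ xs → Unique xs → (∀ {u v} → u ∈ xs → v ∈ xs → Q u → Q v → u ≡ v) →
    length xs ≤ suc (length (filter (¬? ∘ Q?) xs))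
  length≤suc-filter-reject []       _                 _          = z≤n
  length≤suc-filter-reject (x ∷ xs) (x∉xs ∷ xs-unique) atMostOne with Q? x
  ... | yes Qx = s≤s (≤-reflexive (sym (cong length (filter-all (¬? ∘ Q?) none))))
    where
    none : All (¬_ ∘ Q) xs
    none = All.tabulate (λ y∈ Qy → All.lookup x∉xs y∈ (atMostOne (here refl) (there y∈) Qx Qy))
  ... | no ¬Qx = s≤s (length≤suc-filter-reject xs xs-unique (λ u∈ v∈ → atMostOne (there u∈) (there v∈)))

unique-in-range⇒length≤ : ∀ h m bs → Unique bs → All (λ b → m ≤ b × b < h) bs → length bs ≤ h ∸ m
unique-in-range⇒length≤ h       m []       _ _ = z≤n
unique-in-range⇒length≤ zero    m (b ∷ bs) _ ((_ , ()) ∷ _)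
unique-in-range⇒length≤ (suc h) m (b ∷ bs) unique in-range@((m≤b , b≤h) ∷ _) = begin
  length (b ∷ bs)
    ≤⟨ length≤suc-filter-reject (_≟ h) (b ∷ bs) unique (λ _ _ u≡h v≡h → trans u≡h (sym v≡h)) ⟩
  suc (length below-h)
    ≤⟨ s≤s (unique-in-range⇒length≤ h m below-h (Uniqueₚ.filter⁺ (¬? ∘ (_≟ h)) unique) below-h-in-range) ⟩
  suc (h ∸ m)
    ≡⟨ +-∸-assoc 1 (≤-pred (≤-<-trans m≤b b≤h)) ⟨
  suc h ∸ m ∎
  where
  open ≤-Reasoning
  below-h = filter (¬? ∘ (_≟ h)) (b ∷ bs)
  below-h-in-range : All (λ b → m ≤ b × b < h) below-h
  below-h-in-range = All.tabulate λ y∈ → case ∈-filter⁻ (¬? ∘ (_≟ h)) y∈ of λ where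
    (y∈bs , y≢h) → let m≤y , y≤h = All.lookup in-range y∈bs in m≤y , ≤∧≢⇒< (≤-pred y≤h) y≢h

memᵇ-∈ : ∀ {v us} → v ∈ us → memᵇ v us ≡ true
memᵇ-∈ {v} {u ∷ us} (here refl) with v ≡ᵇ v in v≡ᵇv
... | true  = refl
... | false = ⊥-elim (subst T v≡ᵇv (≡⇒≡ᵇ v v refl))
memᵇ-∈ {v} {u ∷ us} (there v∈) with u ≡ᵇ v
... | true  = refl
... | false = memᵇ-∈ v∈

memᵇ≡false⇒∉ : ∀ {v us} → memᵇ v us ≡ false → v ∉ us
memᵇ≡false⇒∉ ¬mem v∈ with trans (sym (memᵇ-∈ v∈)) ¬mem
... | ()

memᵇ-++⁻ : ∀ {v} us vs → memᵇ v (us ++ vs) ≡ false → memᵇ v us ≡ false × memᵇ v vs ≡ false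
memᵇ-++⁻ []            vs ¬mem = refl , ¬mem
memᵇ-++⁻ {v} (u ∷ us) vs ¬mem with u ≡ᵇ v
memᵇ-++⁻ {v} (u ∷ us) vs ()   | true
memᵇ-++⁻ {v} (u ∷ us) vs ¬mem | false = memᵇ-++⁻ us vs ¬mem

firstWith-just : ∀ p xs {a} → AllPairs _<_ xs → firstWith p xs ≡ just a →
  a ∈ xs × p a ≡ true × (∀ v → v ∈ xs → v < a → p v ≡ false)
firstWith-just p (x ∷ xs) (x< ∷ sorted) found with p x in px
firstWith-just p (x ∷ xs) (x< ∷ sorted) refl | true =
  here refl , px , λ { v (here refl) v<x → ⊥-elim (<-irrefl refl v<x)
                     ; v (there v∈)  v<x → ⊥-elim (<-asym v<x (All.lookup x< v∈)) }
... | false with firstWith-just p xs sorted found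
...   | a∈ , pa , below = there a∈ , pa , λ { v (here refl) _ → px ; v (there v∈) v<a → below v v∈ v<a }

firstWith-nothing : ∀ p xs → firstWith p xs ≡ nothing → ∀ v → v ∈ xs → p v ≡ false
firstWith-nothing p (x ∷ xs) none v v∈ with p x in px
firstWith-nothing p (x ∷ xs) () v v∈ | true
... | false with v∈
...   | here refl = px
...   | there v∈xs = firstWith-nothing p xs none v v∈xs

vertices-sorted : ∀ t → AllPairs _<_ (vertices t)
vertices-sorted t = AllPairsₚ.map⁺ (AllPairsₚ.applyUpTo⁺₁ (λ i → i) t (λ i<j _ → s≤s i<j))

∈-vertices⁺ : ∀ {t v} → 1 ≤ v → v ≤ t → v ∈ vertices t
∈-vertices⁺ {v = suc v} _ v≤t = ∈-map⁺ suc (∈-upTo⁺ v≤t)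

∈-vertices⁻ : ∀ {t v} → v ∈ vertices t → 1 ≤ v × v ≤ t
∈-vertices⁻ v∈ with ∈-map⁻ suc v∈
... | _ , v∈upTo , refl = s≤s z≤n , ∈-upTo⁻ v∈upTo

module Greedy (adj : ℕ → ℕ → Bool) (t : ℕ) where

  NonAdjacentRun : List ℕ → Set
  NonAdjacentRun = Linked (λ u v → u < v × adj u v ≡ false)

  private
    extends : List ℕ → ℕ → ℕ → Bool
    extends used cur v = (cur <ᵇ v) ∧ not (memᵇ v used) ∧ not (adj cur v)

    extends-true : ∀ used cur v → extends used cur v ≡ true →
      cur < v × memᵇ v used ≡ false × adj cur v ≡ false
    extends-true used cur v _ with cur <ᵇ v in cur<ᵇv | memᵇ v used | adj cur v
    ... | true | false | false = <ᵇ⇒< cur v (subst T (sym cur<ᵇv) _) , refl , refl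

    extends-false : ∀ used cur v → extends used cur v ≡ false →
      cur < v → memᵇ v used ≡ false → adj cur v ≡ true
    extends-false used cur v _ cur<v _ with cur <ᵇ v in cur<ᵇv | memᵇ v used | adj cur v
    ... | _     | _     | true  = refl
    ... | false | false | false = ⊥-elim (subst T cur<ᵇv (<⇒<ᵇ cur<v))

  extendSet-run : ∀ used cur fuel →
    NonAdjacentRun (cur ∷ extendSet adj t used cur fuel) ×
    All (λ v → memᵇ v used ≡ false × v ≤ t) (extendSet adj t used cur fuel)
  extendSet-run used cur zero = [-] , []
  extendSet-run used cur (suc fuel) with firstWith (extends used cur) (vertices t) in found
  ... | nothing = [-] , []
  ... | just w with firstWith-just (extends used cur) (vertices t) (vertices-sorted t) found
  ...   | w∈ , ext-w , _ with extends-true used cur w ext-w | extendSet-run used w fuel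
  ...     | cur<w , w-unused , ¬adj | run , fresh =
            (cur<w , ¬adj) ∷ run , (w-unused , proj₂ (∈-vertices⁻ w∈)) ∷ fresh

  extendSet-skip : ∀ used cur fuel → t ≤ fuel + cur → ∀ v → cur < v → v ≤ t → memᵇ v used ≡ false →
    v ∉ extendSet adj t used cur fuel →
    ∃ λ b → b ∈ cur ∷ extendSet adj t used cur fuel × b < v × adj b v ≡ true
  extendSet-skip used cur zero t≤fuel+cur v cur<v v≤t _ _ =
    ⊥-elim (<-irrefl refl (≤-trans (<-≤-trans cur<v v≤t) t≤fuel+cur))
  extendSet-skip used cur (suc fuel) t≤fuel+cur v cur<v v≤t v-unused v∉
    with firstWith (extends used cur) (vertices t) in found
  ... | nothing =
        cur , here refl , cur<v ,
        extends-false used cur v (firstWith-nothing _ _ found v v∈vertices) cur<v v-unused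
    where v∈vertices = ∈-vertices⁺ (≤-trans (s≤s z≤n) cur<v) v≤t
  ... | just w with firstWith-just (extends used cur) (vertices t) (vertices-sorted t) found
  ...   | _ , ext-w , least with extends-true used cur w ext-w | <-cmp v w
  ...     | _ , _ , _ | tri< v<w _ _ =
            cur , here refl , cur<v ,
            extends-false used cur v (least v (∈-vertices⁺ (≤-trans (s≤s z≤n) cur<v) v≤t) v<w) cur<v v-unused
  ...     | _ , _ , _ | tri≈ _ refl _ = ⊥-elim (v∉ (here refl))
  ...     | cur<w , _ , _ | tri> _ _ w<v
            with extendSet-skip used w fuel
                   (≤-trans t≤fuel+cur (subst (_≤ fuel + w) (+-suc fuel cur) (+-monoʳ-≤ fuel cur<w)))
                   v w<v v≤t v-unused (v∉ ∘ there)
  ...       | b , b∈ , b<v , adj-bv = b , there b∈ , b<v , adj-bv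

  record GreedySet (used : List ℕ) (p : ℕ) (I : List ℕ) : Set where
    constructor greedySet
    field
      first             : ℕ
      rest              : List ℕ
      I≡first∷rest      : I ≡ first ∷ rest
      run               : NonAdjacentRun (first ∷ rest)
      1≤first           : 1 ≤ first
      ≤t                : All (_≤ t) (first ∷ rest)
      first-unused      : memᵇ first used ≡ false
      blockers          : List ℕ
      blockers-length   : length blockers ≡ p
      blockers-unique   : Unique blockers
      blockers-adjacent : All (λ b → b < first × adj b first ≡ true × memᵇ b used ≡ false) blockers

  -- The set J started at the least unused vertex a₀ did not take the first vertex a of a
  -- later set, so some member of J is below a and adjacent to it.
  greedySet-cons : ∀ {used a₀ p I} →
    (∀ v → v ∈ vertices t → v < a₀ → not (memᵇ v used) ≡ false) → memᵇ a₀ used ≡ false →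
    GreedySet (used ++ a₀ ∷ extendSet adj t used a₀ t) p I → GreedySet used (suc p) I
  greedySet-cons {used} {a₀} least a₀-unused
    (greedySet a as refl run 1≤a ≤t a-unused bs #bs bs-unique bs-adjacent)
    with memᵇ-++⁻ used (a₀ ∷ extendSet adj t used a₀ t) a-unused
  ... | a-unused-used , a-unused-J
    with extendSet-skip used a₀ t (m≤m+n t a₀) a a₀<a (All.head ≤t) a-unused-used (a∉J ∘ there)
    where
    a∉J : a ∉ a₀ ∷ extendSet adj t used a₀ t
    a∉J = memᵇ≡false⇒∉ a-unused-J
    a₀<a : a₀ < a
    a₀<a with <-cmp a₀ a
    ... | tri< a₀<a _ _ = a₀<a
    ... | tri≈ _ refl _ = ⊥-elim (a∉J (here refl))
    ... | tri> _ _ a<a₀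
          with trans (sym (cong not a-unused-used)) (least a (∈-vertices⁺ 1≤a (All.head ≤t)) a<a₀)
    ...   | ()
  ... | b , b∈J , b<a , adj-ba =
        greedySet a as refl run 1≤a ≤t a-unused-used (b ∷ bs) (cong suc #bs)
          (All.map b≢ bs-adjacent ∷ bs-unique)
          ((b<a , adj-ba , All.lookup (a₀-unused ∷ All.map proj₁ (proj₂ (extendSet-run used a₀ t))) b∈J)
           ∷ All.map (λ (b′<a , adj , b′-unused) → b′<a , adj , proj₁ (memᵇ-++⁻ used _ b′-unused)) bs-adjacent)
    where
    b≢ : ∀ {b′} → b′ < a × adj b′ a ≡ true × memᵇ b′ (used ++ _) ≡ false → b ≢ b′
    b≢ (_ , _ , b′-unused) refl = memᵇ≡false⇒∉ (proj₂ (memᵇ-++⁻ used _ b′-unused)) b∈J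

  greedyFrom-set : ∀ fuel used pre I post → greedyFrom adj t used fuel ≡ pre ++ I ∷ post →
    GreedySet used (length pre) I
  greedyFrom-set zero used [] I post ()
  greedyFrom-set zero used (_ ∷ _) I post ()
  greedyFrom-set (suc fuel) used pre I post split
    with firstWith (λ v → not (memᵇ v used)) (vertices t) in found
  greedyFrom-set (suc fuel) used []      I post () | nothing
  greedyFrom-set (suc fuel) used (_ ∷ _) I post () | nothing
  ... | just a₀ with firstWith-just _ (vertices t) (vertices-sorted t) found
  ...   | a₀∈ , a₀-unused , least with pre | split
  ...     | []    | split′ with ∷-injectiveˡ split′
  ...       | refl = greedySet a₀ _ refl run (proj₁ (∈-vertices⁻ a₀∈))
                       (proj₂ (∈-vertices⁻ a₀∈) ∷ All.map proj₂ fresh) (not-injective a₀-unused)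
                       [] refl [] []
    where
    run   = proj₁ (extendSet-run used a₀ t)
    fresh = proj₂ (extendSet-run used a₀ t)
  greedyFrom-set (suc fuel) used _ I post _ | just a₀ | _ , a₀-unused , least | J ∷ pre | split′
    with ∷-injectiveˡ split′
  ... | refl = greedySet-cons least (not-injective a₀-unused)
                 (greedyFrom-set fuel (used ++ J) pre I post (∷-injectiveʳ split′))

  -- The blockers are distinct vertices in [m, first), m the least of them.
  greedySet-gap : ∀ {used p I} (g : GreedySet used p I) → 1 ≤ p →
    ∃ λ m → adj m (GreedySet.first g) ≡ true × p ≤ GreedySet.first g ∸ m
  greedySet-gap (greedySet _ _ _ _ _ _ _ [] #bs _ _) 1≤p = ⊥-elim (<⇒≢ 1≤p #bs)
  greedySet-gap (greedySet a _ _ _ _ _ _ (b ∷ bs) refl unique adjacent) _ =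
    m , proj₁ (proj₂ (argmin-all (λ x → x) (All.head adjacent) (All.tail adjacent))) ,
    unique-in-range⇒length≤ a m (b ∷ bs) unique
      (All.zipWith (λ (m≤b , b<a , _) → m≤b , b<a) (min≤⊤ b bs ∷ min≤xs b bs , adjacent))
    where m = min b bs

  run-ascending : ∀ {v vs} → NonAdjacentRun (v ∷ vs) → AllPairs _<_ (v ∷ vs)
  run-ascending run = Linked⇒AllPairs <-trans (Linked.map proj₁ run)

  run-predecessor : ∀ {v vs j} → NonAdjacentRun (v ∷ vs) → j ∈ vs →
    ∃ λ i → i < j × adj i j ≡ false × v ≤ i × (∀ {u} → u ∈ v ∷ vs → u < j → u ≤ i)
  run-predecessor {v} {w ∷ ws} run@((v<w , ¬adj) ∷ _) (here refl) =
    v , v<w , ¬adj , ≤-refl , λ where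
      (here refl) _   → ≤-refl
      (there u∈)  u<w → ⊥-elim (<⇒≱ u<w (w≤ u∈))
    where
    w≤ : ∀ {u} → u ∈ w ∷ ws → w ≤ u
    w≤ (here refl) = ≤-refl
    w≤ (there u∈)  = <⇒≤ (All.lookup (AllPairs.head (AllPairs.tail (run-ascending run))) u∈)
  run-predecessor {v} ((v<w , _) ∷ run) (there j∈) with run-predecessor run j∈
  ... | i , i<j , ¬adj , w≤i , below = i , i<j , ¬adj , v≤i , λ where
          (here refl) _   → v≤i
          (there u∈)  u<j → below u∈ u<j
    where v≤i = ≤-trans (<⇒≤ v<w) w≤i

module WitnessFamily {n : ℕ} (𝓕 : List (Subset n)) (𝓕-unique : Unique 𝓕) (t : ℕ)
  (chain≤t : ∀ c → IsChain 𝓕 c → length c ≤ t)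
  (adj : ℕ → ℕ → Bool) (Edge⇒adj : ∀ c d → Edge 𝓕 t c d → adj c d ≡ true)
  (a : ℕ) (as : List ℕ) (run : Greedy.NonAdjacentRun adj t (a ∷ as))
  (1≤a : 1 ≤ a) (≤t : All (_≤ t) (a ∷ as))
  (m : ℕ) (𝓧 𝓨 : List (Subset n)) (𝓧-chain : IsLinkChain 𝓕 t m a 𝓧) (𝓨-chain : IsLinkChain 𝓕 t m a 𝓨)
  (chains-disjoint : ∀ Z → Z ∈ 𝓧 → Z ∉ 𝓨)
  (atMostOne : ∀ X₁ Y₁ X₂ Y₂ → X₁ ∈ 𝓧 → Y₁ ∈ 𝓨 → X₂ ∈ 𝓧 → Y₂ ∈ 𝓨 →
     HasRank 𝓕 t (X₁ ∪ Y₁) a → HasRank 𝓕 t (X₂ ∪ Y₂) a → X₁ ∪ Y₁ ≡ X₂ ∪ Y₂)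
  (cross-above : ∀ X Y r → X ∈ 𝓧 → Y ∈ 𝓨 → HasRank 𝓕 t (X ∪ Y) r → a ≤ r)
  where

  open Ranks 𝓕 t chain≤t
  open Greedy adj t using (run-ascending; run-predecessor)

  lev : ℕ → List (Subset n)
  lev = level 𝓕 t

  Cross : Subset n → Set
  Cross Z = Any (λ X → Any (λ Y → X ∪ Y ≡ Z) 𝓨) 𝓧

  Cross? : (Z : Subset n) → Dec (Cross Z)
  Cross? Z = any? (λ X → any? (λ Y → (X ∪ Y) ≟ˢ Z) 𝓨) 𝓧

  levels : List ℕ → List (Subset n)
  levels []       = []
  levels (j ∷ js) = lev j ++ levels js

  lev-a∖Cross : List (Subset n)
  lev-a∖Cross = filter (¬? ∘ Cross?) (lev a)

  family : List (Subset n)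
  family = lev-a∖Cross ++ levels as ++ 𝓧 ++ 𝓨

  data Member (W : Subset n) : Set where
    in-level-a : W ∈ lev a → ¬ Cross W → Member W
    in-level   : ∀ {j} → j ∈ as → W ∈ lev j → Member W
    in-chain   : W ∈ 𝓧 ⊎ W ∈ 𝓨 → Member W

  levels⁻ : ∀ js {W} → W ∈ levels js → ∃ λ j → j ∈ js × W ∈ lev j
  levels⁻ (j ∷ js) W∈ with ∈-++⁻ (lev j) W∈
  ... | inj₁ W∈j  = j , here refl , W∈j
  ... | inj₂ W∈js with levels⁻ js W∈js
  ...   | j′ , j′∈ , W∈j′ = j′ , there j′∈ , W∈j′

  family⁻ : ∀ {W} → W ∈ family → Member W
  family⁻ W∈ with ∈-++⁻ lev-a∖Cross W∈
  ... | inj₁ W∈lev-a∖Cross =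
        let W∈a , ¬cross = ∈-filter⁻ (¬? ∘ Cross?) W∈lev-a∖Cross in in-level-a W∈a ¬cross
  ... | inj₂ W∈rest with ∈-++⁻ (levels as) W∈rest
  ...   | inj₁ W∈levels = let j , j∈ , W∈j = levels⁻ as W∈levels in in-level j∈ W∈j
  ...   | inj₂ W∈chains = in-chain (∈-++⁻ 𝓧 W∈chains)

  a<as : All (a <_) as
  a<as = AllPairs.head (run-ascending run)

  level-a-rank : ∀ {W} → W ∈ lev a → R W a
  level-a-rank W∈ = 1≤a , All.head ≤t , W∈

  level-rank : ∀ {j W} → j ∈ as → W ∈ lev j → R W j
  level-rank j∈ W∈ = ≤-trans 1≤a (<⇒≤ (All.lookup a<as j∈)) , All.lookup (All.tail ≤t) j∈ , W∈

  chain-rank : ∀ {W} → W ∈ 𝓧 ⊎ W ∈ 𝓨 → ∃ λ r → R W r × r < a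
  chain-rank (inj₁ W∈) = let r , rW , _ , r<a = IsLinkChain-rank 𝓧-chain W∈ in r , rW , r<a
  chain-rank (inj₂ W∈) = let r , rW , _ , r<a = IsLinkChain-rank 𝓨-chain W∈ in r , rW , r<a

  member-rank : ∀ {W r} → Member W → R W r → (r < a × (W ∈ 𝓧 ⊎ W ∈ 𝓨)) ⊎ r ∈ a ∷ as
  member-rank (in-level-a W∈ _) rW = inj₂ (subst (_∈ a ∷ as) (rank-unique (level-a-rank W∈) rW) (here refl))
  member-rank (in-level j∈ W∈)  rW = inj₂ (subst (_∈ a ∷ as) (rank-unique (level-rank j∈ W∈) rW) (there j∈))
  member-rank (in-chain W∈)     rW with chain-rank W∈
  ... | r , rW′ , r<a = inj₁ (subst (_< a) (rank-unique rW′ rW) r<a , W∈)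

  family⊆𝓕 : ∀ {W} → W ∈ family → W ∈ 𝓕
  family⊆𝓕 W∈ with family⁻ W∈
  ... | in-level-a W∈a _ = HasRank⇒∈ (level-a-rank W∈a)
  ... | in-level j∈ W∈j  = HasRank⇒∈ (level-rank j∈ W∈j)
  ... | in-chain W∈chain = HasRank⇒∈ (proj₁ (proj₂ (chain-rank W∈chain)))

  below-a⇒chain : ∀ {W r} → W ∈ family → R W r → r < a → W ∈ 𝓧 ⊎ W ∈ 𝓨
  below-a⇒chain W∈ rW r<a with member-rank (family⁻ W∈) rW
  ... | inj₁ (_ , W∈chain) = W∈chain
  ... | inj₂ (here refl)   = ⊥-elim (<-irrefl refl r<a)
  ... | inj₂ (there r∈as)  = ⊥-elim (<-asym r<a (All.lookup a<as r∈as))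

  chains-∪ : ∀ {X Y} → X ∈ 𝓧 ⊎ X ∈ 𝓨 → Y ∈ 𝓧 ⊎ Y ∈ 𝓨 → X ∪ Y ≢ X → X ∪ Y ≢ Y → Cross (X ∪ Y)
  chains-∪         (inj₁ X∈) (inj₂ Y∈) _   _   = lose X∈ (lose Y∈ refl)
  chains-∪ {X} {Y} (inj₂ X∈) (inj₁ Y∈) _   _   = lose Y∈ (lose X∈ (∪-comm Y X))
  chains-∪         (inj₁ X∈) (inj₁ Y∈) ≢X  ≢Y  =
    ⊥-elim ([ ≢X , ≢Y ] (Linked⊂-∪-selective (IsLinkChain-linked 𝓧-chain) X∈ Y∈))
  chains-∪         (inj₂ X∈) (inj₂ Y∈) ≢X  ≢Y  =
    ⊥-elim ([ ≢X , ≢Y ] (Linked⊂-∪-selective (IsLinkChain-linked 𝓨-chain) X∈ Y∈))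

  Cross⇒a≤rank : ∀ {Z r} → Cross Z → R Z r → a ≤ r
  Cross⇒a≤rank cross rZ with find cross
  ... | X , X∈ , cross′ with find cross′
  ...   | Y , Y∈ , refl = cross-above X Y _ X∈ Y∈ rZ

  low-union⇒Cross : ∀ {X Y rX rY r} → X ∈ family → Y ∈ family → R X rX → R Y rY →
    rX < r → rY < r → r ≤ a → X ∪ Y ≢ X → X ∪ Y ≢ Y → Cross (X ∪ Y)
  low-union⇒Cross X∈ Y∈ rX rY rX<r rY<r r≤a =
    chains-∪ (below-a⇒chain X∈ rX (<-≤-trans rX<r r≤a)) (below-a⇒chain Y∈ rY (<-≤-trans rY<r r≤a))

  -- Below j, the members of the family have rank at most the predecessor i of j in the
  -- greedy set, and (i , j) is not an edge of H.
  ¬level-union : ∀ {X Y rX rY j} → X ∈ family → Y ∈ family → R X rX → R Y rY →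
    j ∈ as → R (X ∪ Y) j → rX < j → rY < j → ⊥
  ¬level-union X∈ Y∈ rX rY j∈ rZ rX<j rY<j with run-predecessor run j∈
  ... | i , i<j , ¬adj , a≤i , before-j
    with trans (sym (Edge⇒adj _ _ (∪⇒Edge rX rY (≤i X∈ rX rX<j) (≤i Y∈ rY rY<j) i<j rZ))) ¬adj
    where
    ≤i : ∀ {W r} → W ∈ family → R W r → r < _ → r ≤ i
    ≤i W∈ rW r<j with member-rank (family⁻ W∈) rW
    ... | inj₁ (r<a , _) = ≤-trans (<⇒≤ r<a) a≤i
    ... | inj₂ r∈run     = before-j r∈run r<j
  ... | ()

  family-unionFree : UnionFree family
  family-unionFree X Y _ X∈ Y∈ Z∈ _ Y≢Z X≢Z refl
    with rank-exists (family⊆𝓕 X∈) | rank-exists (family⊆𝓕 Y∈) | rank-exists (family⊆𝓕 Z∈)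
  ... | rX , x | rY , y | rZ , z = no-union (family⁻ Z∈)
    where
    rX<rZ = rank-⊂ (⊆∧≢⇒⊂ (p⊆p∪q Y) X≢Z) x z
    rY<rZ = rank-⊂ (⊆∧≢⇒⊂ (q⊆p∪q X Y) Y≢Z) y z

    no-union : Member (X ∪ Y) → ⊥
    no-union (in-level-a Z∈a ¬cross) =
      ¬cross (low-union⇒Cross X∈ Y∈ x y rX<rZ rY<rZ (≤-reflexive (rank-unique z (level-a-rank Z∈a)))
                (X≢Z ∘ sym) (Y≢Z ∘ sym))
    no-union (in-chain Z∈chain) with chain-rank Z∈chain
    ... | _ , z′ , rZ′<a with rank-unique z′ z
    ...   | refl = <⇒≱ rZ′<a (Cross⇒a≤rank
                     (low-union⇒Cross X∈ Y∈ x y rX<rZ rY<rZ (<⇒≤ rZ′<a) (X≢Z ∘ sym) (Y≢Z ∘ sym)) z)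
    no-union (in-level j∈ Z∈j) with rank-unique (level-rank j∈ Z∈j) z
    ... | refl = ¬level-union X∈ Y∈ x y j∈ z rX<rZ rY<rZ

  lev-a∖Cross-ranked : ∀ {W} → W ∈ lev-a∖Cross → ∃ λ r → R W r × r ≡ a
  lev-a∖Cross-ranked W∈ = a , level-a-rank (proj₁ (∈-filter⁻ (¬? ∘ Cross?) W∈)) , refl

  levels-ranked : ∀ {W} → W ∈ levels as → ∃ λ r → R W r × a < r
  levels-ranked W∈ with levels⁻ as W∈
  ... | j , j∈ , W∈j = j , level-rank j∈ W∈j , All.lookup a<as j∈

  chains-ranked : ∀ {W} → W ∈ 𝓧 ++ 𝓨 → ∃ λ r → R W r × r < a
  chains-ranked W∈ = chain-rank (∈-++⁻ 𝓧 W∈)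

  rest-ranked : ∀ {W} → W ∈ levels as ++ 𝓧 ++ 𝓨 → ∃ λ r → R W r × r ≢ a
  rest-ranked W∈ with ∈-++⁻ (levels as) W∈
  ... | inj₁ W∈levels = let r , rW , a<r = levels-ranked W∈levels in r , rW , >⇒≢ a<r
  ... | inj₂ W∈chains = let r , rW , r<a = chains-ranked W∈chains in r , rW , <⇒≢ r<a

  levels-unique : ∀ js → Unique js → (∀ {j} → j ∈ js → j ∈ as) → Unique (levels js)
  levels-unique []       _                   _   = []
  levels-unique (j ∷ js) (j∉js ∷ js-unique) ⊆as =
    Uniqueₚ.++⁺ (level-unique 𝓕-unique j) (levels-unique js js-unique (⊆as ∘ there))
      (Disjoint-by-rank {P = _≡ j} (λ W∈ → j , level-rank (⊆as (here refl)) W∈ , refl) in-js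
        (λ { refl j∈js → All.lookup j∉js j∈js refl }))
    where
    in-js : ∀ {W} → W ∈ levels js → ∃ λ r → R W r × r ∈ js
    in-js W∈ with levels⁻ js W∈
    ... | j′ , j′∈ , W∈j′ = j′ , level-rank (⊆as (there j′∈)) W∈j′ , j′∈

  family-unique : Unique family
  family-unique =
    Uniqueₚ.++⁺ (Uniqueₚ.filter⁺ (¬? ∘ Cross?) (level-unique 𝓕-unique a))
      (Uniqueₚ.++⁺ (levels-unique as as-unique (λ j∈ → j∈))
        (Uniqueₚ.++⁺ (Linked⊂⇒Unique (IsLinkChain-linked 𝓧-chain))
                     (Linked⊂⇒Unique (IsLinkChain-linked 𝓨-chain))
          (λ (W∈𝓧 , W∈𝓨) → chains-disjoint _ W∈𝓧 W∈𝓨))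
        (Disjoint-by-rank levels-ranked chains-ranked <-asym))
      (Disjoint-by-rank lev-a∖Cross-ranked rest-ranked (λ r≡a r≢a → r≢a r≡a))
    where
    as-unique : Unique as
    as-unique = AllPairs.map (λ u<v → <⇒≢ u<v) (AllPairs.tail (run-ascending run))

  length-levels : ∀ js → length (levels js) ≡ levelSizeSum 𝓕 t js
  length-levels []       = refl
  length-levels (j ∷ js) = trans (length-++ (lev j)) (cong (length (lev j) +_) (length-levels js))

  length-family : length family ≡ length lev-a∖Cross + (levelSizeSum 𝓕 t as + (a ∸ m + (a ∸ m)))
  length-family = begin
    length (lev-a∖Cross ++ levels as ++ 𝓧 ++ 𝓨)
      ≡⟨ length-++ lev-a∖Cross ⟩
    length lev-a∖Cross + length (levels as ++ 𝓧 ++ 𝓨)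
      ≡⟨ cong (length lev-a∖Cross +_) (length-++ (levels as)) ⟩
    length lev-a∖Cross + (length (levels as) + length (𝓧 ++ 𝓨))
      ≡⟨ cong (length lev-a∖Cross +_) (cong₂ _+_ (length-levels as) (trans (length-++ 𝓧)
           (cong₂ _+_ (IsLinkChain-length 𝓧-chain) (IsLinkChain-length 𝓨-chain)))) ⟩
    length lev-a∖Cross + (levelSizeSum 𝓕 t as + (a ∸ m + (a ∸ m))) ∎
    where open ≡-Reasoning

  -- By atMostOne, filtering the unions X ∪ Y out of level a removes at most one set.
  level-a-length : length (lev a) ≤ suc (length lev-a∖Cross)
  level-a-length = length≤suc-filter-reject Cross? (lev a) (level-unique 𝓕-unique a) cross-unique
    where
    cross-unique : ∀ {U V} → U ∈ lev a → V ∈ lev a → Cross U → Cross V → U ≡ V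
    cross-unique U∈ V∈ crossU crossV with find crossU | find crossV
    ... | X₁ , X₁∈ , crossU′ | X₂ , X₂∈ , crossV′ with find crossU′ | find crossV′
    ...   | Y₁ , Y₁∈ , refl | Y₂ , Y₂∈ , refl =
            atMostOne X₁ Y₁ X₂ Y₂ X₁∈ Y₁∈ X₂∈ Y₂∈ (level-a-rank U∈) (level-a-rank V∈)

  levelSizeSum-bound : ∀ {α p} → (∀ G → Unique G → All (_∈ 𝓕) G → UnionFree G → length G ≤ α) →
    p ≤ a ∸ m → levelSizeSum 𝓕 t (a ∷ as) + 2 * suc p ≤ α + 3
  levelSizeSum-bound {α} {p} max-unionFree p≤a∸m = begin
    length (lev a) + S + 2 * suc p
      ≤⟨ +-mono-≤ (+-monoˡ-≤ S level-a-length) (*-monoʳ-≤ 2 (s≤s p≤a∸m)) ⟩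
    suc (length lev-a∖Cross) + S + 2 * suc (a ∸ m)
      ≡⟨ rearrange (length lev-a∖Cross) S (a ∸ m) ⟩
    length lev-a∖Cross + (S + (a ∸ m + (a ∸ m))) + 3
      ≡⟨ cong (_+ 3) length-family ⟨
    length family + 3
      ≤⟨ +-monoˡ-≤ 3 (max-unionFree family family-unique (All.tabulate family⊆𝓕) family-unionFree) ⟩
    α + 3 ∎
    where
    open ≤-Reasoning
    open +-*-Solver
    S = levelSizeSum 𝓕 t as
    rearrange : ∀ x s k → suc x + s + 2 * suc k ≡ x + (s + (k + k)) + 3
    rearrange = solve 3 (λ x s k → con 1 :+ x :+ s :+ con 2 :* (con 1 :+ k) := x :+ (s :+ (k :+ k)) :+ con 3) refl

open Greedy using (greedySet; greedyFrom-set; greedySet-gap)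

lemma3 : (n : ℕ) (𝓕 : List (Subset n)) → Unique 𝓕 → 𝓕 ≢ [] →
    (t : ℕ) → IsMaxChainLength 𝓕 t →
    (α : ℕ) → IsMaxUnionFree 𝓕 α →
    (adj : ℕ → ℕ → Bool) → (∀ a b → (adj a b ≡ true) ⇔ Edge 𝓕 t a b) →
    (pre : List (List ℕ)) (I : List ℕ) (post : List (List ℕ)) →
    greedy adj t ≡ pre ++ I ∷ post →
    1 ≤ length pre →
    levelSizeSum 𝓕 t I + 2 * suc (length pre) ≤ α + 3
lemma3 n 𝓕 𝓕-unique _ t (_ , chain≤t) α (_ , max-unionFree) adj adj⇔Edge pre I post greedy≡ 1≤p
  with greedyFrom-set adj t t [] pre I post greedy≡
... | g@(greedySet a as refl run 1≤a ≤t _ _ _ _ _) with greedySet-gap adj t g 1≤p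
...   | m , adj-ma , p≤a∸m with Equivalence.to (adj⇔Edge m a) adj-ma
...     | _ , _ , _ , 𝓧 , 𝓨 , 𝓧-chain , 𝓨-chain , disjoint , atMostOne , above =
          WitnessFamily.levelSizeSum-bound 𝓕 𝓕-unique t chain≤t adj (λ c d → Equivalence.from (adj⇔Edge c d))
            a as run 1≤a ≤t m 𝓧 𝓨 𝓧-chain 𝓨-chain disjoint atMostOne above max-unionFree p≤a∸m
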